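{- Let $n\geq 2$, let $p$ be a prime, and let $x_1,\dots,x_n$ be positive integers with $\frac{1}{x_1}+\dots+\frac{1}{x_n}=1$. Then there exist indices $k\neq l$ with $v_p(x_k)=v_p(x_l)$.
   Context: $v_p$ denotes the $p$-adic valuation. -}

module Defs where

open import Data.Nat using (ℕ; suc; _^_; NonZero)
open import Data.Nat.Divisibility using (_∣_)
open import Data.Fin using (Fin; zero; suc)
open import Data.Integer using (+_)
open import Data.Rational using (ℚ; _/_; _+_; 0ℚ)
open import Relation.Nullary using (¬_)
open import Data.Product using (_×_)

-- v_p(x) = a : p-adic valuation, as a relation (p^a ∣ x and p^(a+1) ∤ x).
-- For p prime and x > 0 there is exactly one such a.
IsVal : ℕ → ℕ → ℕ → Set
IsVal p x a = (p ^ a) ∣ x × ¬ ((p ^ suc a) ∣ x)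

sumRecip : (n : ℕ) (x : Fin n → ℕ) → ((i : Fin n) → NonZero (x i)) → ℚ
sumRecip ℕ.zero x nz = 0ℚ
sumRecip (suc n) x nz =
  ((+ 1) / x zero) {{nz zero}} + sumRecip n (λ i → x (suc i)) (λ i → nz (suc i))

{-# OPTIONS --safe #-}
module Submission where

-- Clearing denominators, Σᵢ 1/xᵢ = 1 becomes N = P with P = ∏ xᵢ and N = Σᵢ ∏_{j≠i} xⱼ.
-- If the valuations vᵢ = v_p(xᵢ) were pairwise distinct, the largest one, a, would be
-- attained exactly once, so the summand of N omitting that index would have strictly
-- smaller valuation than all the others and v_p(N) = Σ vᵢ − a.  As v_p(P) = Σ vᵢ, this
-- forces a = 0; but then all n ≥ 2 valuations vanish, contradicting their distinctness.

open import Defs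
open import Data.Empty using (⊥-elim)
open import Data.Fin using (Fin; zero; suc; _≟_)
import Data.Fin.Properties as Finₚ
open import Data.Integer as ℤ using (+_)
import Data.Integer.Properties as ℤₚ
open import Data.Nat
  using (ℕ; zero; suc; NonZero; ≢-nonZero; ≢-nonZero⁻¹; nonTrivial⇒n>1; _+_; _*_; _^_; _∸_; _≤_; _<_; s≤s; z≤n)
open import Data.Nat.Divisibility
open import Data.Nat.Induction using (<-wellFounded)
open import Data.Nat.Primality using (Prime; euclidsLemma; prime⇒nonZero; prime⇒nonTrivial)
open import Data.Nat.Properties renaming (_≟_ to _≟ℕ_)
open import Data.Product using (_×_; _,_; ∃-syntax; proj₁; proj₂)
open import Data.Rational using (1ℚ; toℚᵘ)
import Data.Rational as ℚ
import Data.Rational.Properties as ℚₚ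
open import Data.Rational.Unnormalised as ℚᵘ using (mkℚᵘ; *≡*; _≃_)
import Data.Rational.Unnormalised.Properties as ℚᵘₚ
open import Data.Sum using (_⊎_; inj₁; inj₂; [_,_])
open import Data.Vec.Functional using (tail)
open import Function using (_∘_)
open import Function.Definitions using (Injective)
open import Induction.WellFounded using (Acc; acc)
open import Relation.Binary.Definitions using (tri<; tri≈; tri>)
open import Relation.Binary.PropositionalEquality hiding ([_])
open import Relation.Nullary using (¬_; yes; no)
open import Relation.Nullary.Decidable using (¬?; _×-dec_)

sum : (n : ℕ) → (Fin n → ℕ) → ℕ
sum zero    v = 0
sum (suc n) v = v zero + sum n (tail v)

product : (n : ℕ) → (Fin n → ℕ) → ℕ
product zero    x = 1
product (suc n) x = x zero * product n (tail x)

-- Σᵢ ∏_{j ≠ i} x j, the numerator of Σᵢ 1/x i over the denominator product n x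
recipNumerator : (n : ℕ) → (Fin n → ℕ) → ℕ
recipNumerator zero    x = 0
recipNumerator (suc n) x = product n (tail x) + x zero * recipNumerator n (tail x)

product-nonZero : ∀ n (x : Fin n → ℕ) → (∀ i → NonZero (x i)) → NonZero (product n x)
product-nonZero zero    x pos = _
product-nonZero (suc n) x pos =
  m*n≢0 (x zero) _ {{pos zero}} {{product-nonZero n (tail x) (pos ∘ suc)}}

1/a+N/d≃[d+a*N]/[a*d] : ∀ a d N .{{_ : NonZero a}} .{{_ : NonZero d}} →
           (+ 1 ℚᵘ./ a) ℚᵘ.+ (+ N ℚᵘ./ d) ≃ (+ (d + a * N) ℚᵘ./ (a * d)) {{m*n≢0 a d}}
1/a+N/d≃[d+a*N]/[a*d] a@(suc _) d@(suc _) N = ℚᵘₚ.≃-reflexive (ℚᵘₚ./-cong numerator refl)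
  where
  open ≡-Reasoning
  numerator : + 1 ℤ.* + d ℤ.+ + N ℤ.* + a ≡ + (d + a * N)
  numerator = begin
    + 1 ℤ.* + d ℤ.+ + N ℤ.* + a  ≡⟨ cong₂ ℤ._+_ (ℤₚ.*-identityˡ (+ d)) (sym (ℤₚ.pos-* N a)) ⟩
    + d ℤ.+ + (N * a)            ≡⟨ sym (ℤₚ.pos-+ d (N * a)) ⟩
    + (d + N * a)                ≡⟨ cong (λ t → + (d + t)) (*-comm N a) ⟩
    + (d + a * N)                ∎

toℚᵘ-/ : ∀ i n .{{_ : NonZero n}} → toℚᵘ (i ℚ./ n) ≃ (i ℚᵘ./ n)
toℚᵘ-/ i (suc n) = ℚₚ.toℚᵘ-fromℚᵘ (mkℚᵘ i n)

sumRecip≃recipNumerator/product : ∀ n x pos →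
  toℚᵘ (sumRecip n x pos) ≃ (+ recipNumerator n x ℚᵘ./ product n x) {{product-nonZero n x pos}}
sumRecip≃recipNumerator/product zero    x pos = *≡* refl
sumRecip≃recipNumerator/product (suc n) x pos = begin
  toℚᵘ (1/x₀ ℚ.+ rest)                          ≈⟨ ℚₚ.toℚᵘ-homo-+ 1/x₀ rest ⟩
  toℚᵘ 1/x₀ ℚᵘ.+ toℚᵘ rest                      ≈⟨ ℚᵘₚ.+-cong (toℚᵘ-/ (+ 1) (x zero))
                                                    (sumRecip≃recipNumerator/product n (tail x) (pos ∘ suc)) ⟩
  (+ 1 ℚᵘ./ x zero) ℚᵘ.+ (+ N ℚᵘ./ D)          ≈⟨ 1/a+N/d≃[d+a*N]/[a*d] (x zero) D N ⟩
  + recipNumerator (suc n) x ℚᵘ./ product (suc n) x ∎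
  where
  open ℚᵘₚ.≃-Reasoning
  instance
    x₀≢0 : NonZero (x zero)
    x₀≢0 = pos zero
    D≢0 : NonZero (product n (tail x))
    D≢0 = product-nonZero n (tail x) (pos ∘ suc)
    P≢0 : NonZero (product (suc n) x)
    P≢0 = product-nonZero (suc n) x pos
  1/x₀ rest : ℚ.ℚ
  1/x₀ = + 1 ℚ./ x zero
  rest = sumRecip n (tail x) (pos ∘ suc)
  N D : ℕ
  N = recipNumerator n (tail x)
  D = product n (tail x)

sumRecip≡1⇒recipNumerator≡product : ∀ n x pos → sumRecip n x pos ≡ 1ℚ →
                                    recipNumerator n x ≡ product n x
sumRecip≡1⇒recipNumerator≡product n x pos sum≡1 =
  N/D≃1⇒N≡D (ℚᵘₚ.≃-trans (ℚᵘₚ.≃-sym (sumRecip≃recipNumerator/product n x pos))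
                          (ℚₚ.toℚᵘ-cong sum≡1))
  where
  instance _ = product-nonZero n x pos
  N/D≃1⇒N≡D : ∀ {N D} .{{_ : NonZero D}} → (+ N ℚᵘ./ D) ≃ ℚᵘ.1ℚᵘ → N ≡ D
  N/D≃1⇒N≡D {N} {suc d} (*≡* eq) =
    ℤₚ.+-injective (trans (sym (ℤₚ.*-identityʳ (+ N))) (trans eq (ℤₚ.*-identityˡ (+ suc d))))

^-monoʳ-∣ : ∀ p {m n} → m ≤ n → p ^ m ∣ p ^ n
^-monoʳ-∣ p {m} {n} m≤n = divides (p ^ (n ∸ m)) (begin
  p ^ n                ≡⟨ cong (p ^_) (sym (m+[n∸m]≡n m≤n)) ⟩
  p ^ (m + (n ∸ m))    ≡⟨ ^-distribˡ-+-* p m (n ∸ m) ⟩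
  p ^ m * p ^ (n ∸ m)  ≡⟨ *-comm (p ^ m) (p ^ (n ∸ m)) ⟩
  p ^ (n ∸ m) * p ^ m  ∎)
  where open ≡-Reasoning

IsMaximum : ∀ {n} → (Fin n → ℕ) → ℕ → Set
IsMaximum v a = (∀ i → v i ≤ a) × ∃[ i ] v i ≡ a

module _ {p : ℕ} where

  IsVal-unique : ∀ {x a b} → IsVal p x a → IsVal p x b → a ≡ b
  IsVal-unique {a = a} {b} (pᵃ∣x , pᵃ⁺¹∤x) (pᵇ∣x , pᵇ⁺¹∤x) with <-cmp a b
  ... | tri< a<b _ _ = ⊥-elim (pᵃ⁺¹∤x (∣-trans (^-monoʳ-∣ p a<b) pᵇ∣x))
  ... | tri≈ _ a≡b _ = a≡b
  ... | tri> _ _ b<a = ⊥-elim (pᵇ⁺¹∤x (∣-trans (^-monoʳ-∣ p b<a) pᵃ∣x))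

  IsVal-+ˡ : ∀ {y z a b} → IsVal p y a → IsVal p z b → a < b → IsVal p (y + z) a
  IsVal-+ˡ {y} {z} {a} (pᵃ∣y , pᵃ⁺¹∤y) (pᵇ∣z , _) a<b =
    ∣m∣n⇒∣m+n pᵃ∣y (∣-trans (^-monoʳ-∣ p (<⇒≤ a<b)) pᵇ∣z) ,
    λ pᵃ⁺¹∣y+z → pᵃ⁺¹∤y (∣m+n∣m⇒∣n (subst (p ^ suc a ∣_) (+-comm y z) pᵃ⁺¹∣y+z)
                                   (∣-trans (^-monoʳ-∣ p a<b) pᵇ∣z))

  IsVal-+ʳ : ∀ {y z a b} → IsVal p y a → IsVal p z b → b < a → IsVal p (y + z) b
  IsVal-+ʳ {y} {z} {b = b} vy vz b<a = subst (λ t → IsVal p t b) (+-comm z y) (IsVal-+ˡ vz vy b<a)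

module _ {p : ℕ} (p-prime : Prime p) where

  private instance
    p≢0 : NonZero p
    p≢0 = prime⇒nonZero p-prime

  cofactor⇒IsVal : ∀ {x a} q → x ≡ q * p ^ a → ¬ p ∣ q → IsVal p x a
  cofactor⇒IsVal {a = a} q refl p∤q =
    n∣m*n q , λ pᵃ⁺¹∣x → p∤q (*-cancelʳ-∣ (p ^ a) {{m^n≢0 p a}} pᵃ⁺¹∣x)

  IsVal⇒cofactor : ∀ {x a} → IsVal p x a → ∃[ q ] (x ≡ q * p ^ a × ¬ p ∣ q)
  IsVal⇒cofactor {x} {a} (divides q x≡qpᵃ , pᵃ⁺¹∤x) =
    q , x≡qpᵃ , λ { (divides r q≡rp) → pᵃ⁺¹∤x (divides r (begin
      x                ≡⟨ x≡qpᵃ ⟩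
      q * p ^ a        ≡⟨ cong (_* p ^ a) q≡rp ⟩
      r * p * p ^ a    ≡⟨ *-assoc r p (p ^ a) ⟩
      r * p ^ suc a    ∎)) }
    where open ≡-Reasoning

  IsVal-1 : IsVal p 1 0
  IsVal-1 = cofactor⇒IsVal {a = 0} 1 refl λ p∣1 →
    <⇒≢ (nonTrivial⇒n>1 p {{prime⇒nonTrivial p-prime}}) (sym (∣1⇒≡1 p∣1))

  IsVal-* : ∀ {x y a b} → IsVal p x a → IsVal p y b → IsVal p (x * y) (a + b)
  IsVal-* {x} {y} {a} {b} vx vy with IsVal⇒cofactor {a = a} vx | IsVal⇒cofactor {a = b} vy
  ... | q , x≡qpᵃ , p∤q | r , y≡rpᵇ , p∤r =
    cofactor⇒IsVal {a = a + b} (q * r) xy≡qr*pᵃ⁺ᵇ ([ p∤q , p∤r ] ∘ euclidsLemma q r p-prime)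
    where
    open ≡-Reasoning
    xy≡qr*pᵃ⁺ᵇ : x * y ≡ q * r * p ^ (a + b)
    xy≡qr*pᵃ⁺ᵇ = begin
      x * y                    ≡⟨ cong₂ _*_ x≡qpᵃ y≡rpᵇ ⟩
      q * p ^ a * (r * p ^ b)  ≡⟨ [m*n]*[o*p]≡[m*o]*[n*p] q (p ^ a) r (p ^ b) ⟩
      q * r * (p ^ a * p ^ b)  ≡⟨ cong (q * r *_) (sym (^-distribˡ-+-* p a b)) ⟩
      q * r * p ^ (a + b)      ∎

  IsVal-exists : ∀ x .{{_ : NonZero x}} → ∃[ a ] IsVal p x a
  IsVal-exists x = go x (<-wellFounded x)
    where
    go : ∀ x .{{_ : NonZero x}} → Acc _<_ x → ∃[ a ] IsVal p x a
    go x (acc rec) with p ∣? x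
    ... | no p∤x = 0 , cofactor⇒IsVal {a = 0} x (sym (*-identityʳ x)) p∤x
    ... | yes (divides q x≡qp) with go q {{q≢0}} (rec q<x)
      where
      q≢0 : NonZero q
      q≢0 = ≢-nonZero λ { refl → ≢-nonZero⁻¹ x x≡qp }
      q<x : q < x
      q<x = subst (q <_) (sym x≡qp) (m<m*n q p {{q≢0}} (nonTrivial⇒n>1 p {{prime⇒nonTrivial p-prime}}))
    ...   | a , vq with IsVal⇒cofactor {a = a} vq
    ...     | r , q≡rpᵃ , p∤r = suc a , cofactor⇒IsVal {a = suc a} r x≡rpᵃ⁺¹ p∤r
      where
      open ≡-Reasoning
      x≡rpᵃ⁺¹ : x ≡ r * p ^ suc a
      x≡rpᵃ⁺¹ = begin
        x               ≡⟨ x≡qp ⟩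
        q * p           ≡⟨ cong (_* p) q≡rpᵃ ⟩
        r * p ^ a * p   ≡⟨ *-assoc r (p ^ a) p ⟩
        r * (p ^ a * p) ≡⟨ cong (r *_) (*-comm (p ^ a) p) ⟩
        r * p ^ suc a   ∎

  IsVal-product : ∀ n {x v : Fin n → ℕ} → (∀ i → IsVal p (x i) (v i)) →
                  IsVal p (product n x) (sum n v)
  IsVal-product zero    vx = IsVal-1
  IsVal-product (suc n) {v = v} vx =
    IsVal-* {a = v zero} (vx zero) (IsVal-product n {v = tail v} (vx ∘ suc))

  -- The maximum is attained at a single index, whose summand has the least valuation.
  IsVal-recipNumerator : ∀ n {x v : Fin (suc n) → ℕ} → (∀ i → IsVal p (x i) (v i)) →
    Injective _≡_ _≡_ v →
    ∃[ a ] (IsMaximum v a × ∃[ b ] (IsVal p (recipNumerator (suc n) x) b × b + a ≡ sum (suc n) v))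
  IsVal-recipNumerator zero {x} {v} vx _ =
    v zero , ((λ { zero → ≤-refl }) , zero , refl) , 0 ,
    subst (λ N → IsVal p N 0) (cong suc (sym (*-zeroʳ (x zero)))) IsVal-1 ,
    sym (+-identityʳ (v zero))
  IsVal-recipNumerator (suc n) {x} {v} vx v-inj
    with IsVal-recipNumerator n {v = tail v} (vx ∘ suc) (Finₚ.suc-injective ∘ v-inj)
  ... | a , (v≤a , i , vᵢ≡a) , b , vN , b+a≡Σ with <-cmp (v zero) a
  ...   | tri< v₀<a _ _ =
          a , ((λ { zero → <⇒≤ v₀<a ; (suc j) → v≤a j }) , suc i , vᵢ≡a) ,
          v zero + b ,
          IsVal-+ʳ (IsVal-product (suc n) {v = tail v} (vx ∘ suc))
                   (IsVal-* {a = v zero} {b} (vx zero) vN)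
            (subst (v zero + b <_) (trans (+-comm a b) b+a≡Σ) (+-monoˡ-< b v₀<a)) ,
          trans (+-assoc (v zero) b a) (cong (λ s → v zero + s) b+a≡Σ)
  ...   | tri≈ _ v₀≡a _ = ⊥-elim (Finₚ.0≢1+n (v-inj (trans v₀≡a (sym vᵢ≡a))))
  ...   | tri> _ _ a<v₀ =
          v zero , ((λ { zero → ≤-refl ; (suc j) → ≤-trans (v≤a j) (<⇒≤ a<v₀) }) , zero , refl) ,
          sum (suc n) (tail v) ,
          IsVal-+ˡ (IsVal-product (suc n) {v = tail v} (vx ∘ suc))
                   (IsVal-* {a = v zero} {b} (vx zero) vN)
            (subst (_< v zero + b) (trans (+-comm a b) b+a≡Σ) (+-monoˡ-< b a<v₀)) ,
          +-comm (sum (suc n) (tail v)) (v zero)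

  distinct-IsVal⇒recipNumerator≢product : ∀ n {x v : Fin (2 + n) → ℕ} →
    (∀ i → IsVal p (x i) (v i)) → Injective _≡_ _≡_ v →
    recipNumerator (2 + n) x ≢ product (2 + n) x
  distinct-IsVal⇒recipNumerator≢product n {x} {v} vx v-inj N≡P
    with IsVal-recipNumerator (suc n) {v = v} vx v-inj
  ... | a , (v≤a , _) , b , vN , b+a≡Σ =
    Finₚ.0≢1+n (v-inj (trans (v≡0 zero) (sym (v≡0 (suc zero)))))
    where
    b≡Σ : b ≡ sum (2 + n) v
    b≡Σ = IsVal-unique (subst (λ N → IsVal p N b) N≡P vN) (IsVal-product (2 + n) {v = v} vx)
    a≡0 : a ≡ 0
    a≡0 = +-cancelˡ-≡ b a 0 (trans b+a≡Σ (trans (sym b≡Σ) (sym (+-identityʳ b))))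
    v≡0 : ∀ i → v i ≡ 0
    v≡0 i = n≤0⇒n≡0 (subst (v i ≤_) a≡0 (v≤a i))

injective⊎collision : ∀ {n} (v : Fin n → ℕ) →
                      Injective _≡_ _≡_ v ⊎ ∃[ k ] ∃[ l ] (k ≢ l × v k ≡ v l)
injective⊎collision v with Finₚ.any? (λ k → Finₚ.any? (λ l → ¬? (k ≟ l) ×-dec (v k ≟ℕ v l)))
... | yes (k , l , k≢l , vₖ≡vₗ) = inj₂ (k , l , k≢l , vₖ≡vₗ)
... | no no-collision = inj₁ injective
  where
  injective : Injective _≡_ _≡_ v
  injective {k} {l} vₖ≡vₗ with k ≟ l
  ... | yes k≡l = k≡l
  ... | no k≢l = ⊥-elim (no-collision (k , l , k≢l , vₖ≡vₗ))

proposition1 : (n : ℕ) → 2 ≤ n → (p : ℕ) → Prime p →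
    (x : Fin n → ℕ) → (pos : (i : Fin n) → NonZero (x i)) →
    sumRecip n x pos ≡ 1ℚ →
    ∃[ k ] ∃[ l ] (k ≢ l × ∃[ a ] (IsVal p (x k) a × IsVal p (x l) a))
proposition1 (suc (suc m)) (s≤s (s≤s z≤n)) p p-prime x pos sum≡1 =
  [ (λ (v-injective : Injective _≡_ _≡_ v) →
      ⊥-elim (distinct-IsVal⇒recipNumerator≢product p-prime m (proj₂ ∘ valuation) v-injective N≡P))
  , (λ (k , l , k≢l , vₖ≡vₗ) →
      k , l , k≢l , v k , proj₂ (valuation k) , subst (IsVal p (x l)) (sym vₖ≡vₗ) (proj₂ (valuation l)))
  ] (injective⊎collision v)
  where
  valuation : ∀ i → ∃[ a ] IsVal p (x i) a
  valuation i = IsVal-exists p-prime (x i) {{pos i}}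
  v : Fin (2 + m) → ℕ
  v = proj₁ ∘ valuation
  N≡P : recipNumerator (2 + m) x ≡ product (2 + m) x
  N≡P = sumRecip≡1⇒recipNumerator≡product (2 + m) x pos sum≡1
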